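{- For every integer $j \geq 3$, $$m_j(B, P_2) = \begin{cases} 2 & \text{if } j \in \{3,4\},\\ 1 & \text{otherwise.}\end{cases}$$
   Context: All graphs are simple. $K_{j\times s}$ denotes the complete multipartite graph with $j$ partite sets, each of size $s$. The Butterfly graph $B$ is the graph on 5 vertices consisting of two copies of the triangle $C_3$ sharing exactly one common vertex. $P_n$ denotes the path on $n$ vertices (so $P_2$ is a single edge). For graphs $B$ and $G$ and an integer $j\ge 2$, the size multipartite Ramsey number $m_j(B,G)$ is the smallest natural number $s$ such that every colouring of the edges of $K_{j\times s}$ with two colours, red and blue, contains a red copy of $B$ or a blue copy of $G$; if no such $s$ exists, $m_j(B,G)=\infty$. -}

module Defs where

open import Data.Nat using (ℕ; _<_)
open import Data.Fin using (Fin; zero; suc)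
open import Data.Product using (Σ; _×_; _,_)
open import Data.Sum using (_⊎_)
open import Data.Unit using (⊤)
open import Data.Empty using (⊥)
open import Relation.Nullary using (¬_)
open import Relation.Binary.PropositionalEquality using (_≡_)
open import Function.Definitions using (Injective)

-- Vertices of the complete multipartite graph K_{j×s}:
-- a vertex is (partite set index, position inside the set).
Vertex : ℕ → ℕ → Set
Vertex j s = Fin j × Fin s

Adj : {j s : ℕ} → Vertex j s → Vertex j s → Set
Adj (p , _) (q , _) = ¬ (p ≡ q)

data Colour : Set where
  red blue : Colour

-- A red/blue colouring of the edges of K_{j×s}: a symmetric colour assignment to
-- pairs of vertices (only values on adjacent pairs are ever used).
record Colouring (j s : ℕ) : Set where
  field
    col : Vertex j s → Vertex j s → Colour
    sym : ∀ u v → col u v ≡ col v u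
open Colouring public

-- Edge relation of the Butterfly graph B on vertex set {0,…,4}:
-- two triangles 0-1-2 and 0-3-4 sharing the vertex 0.
BEdge : Fin 5 → Fin 5 → Set
BEdge zero (suc zero) = ⊤
BEdge zero (suc (suc zero)) = ⊤
BEdge (suc zero) (suc (suc zero)) = ⊤
BEdge zero (suc (suc (suc zero))) = ⊤
BEdge zero (suc (suc (suc (suc zero)))) = ⊤
BEdge (suc (suc (suc zero))) (suc (suc (suc (suc zero)))) = ⊤
BEdge _ _ = ⊥

RedButterfly : {j s : ℕ} → Colouring j s → Set
RedButterfly {j} {s} c =
  Σ (Fin 5 → Vertex j s) λ f →
    Injective _≡_ _≡_ f ×
    (∀ a b → BEdge a b → Adj (f a) (f b) × col c (f a) (f b) ≡ red)

BlueP2 : {j s : ℕ} → Colouring j s → Set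
BlueP2 {j} {s} c =
  Σ (Vertex j s) λ u → Σ (Vertex j s) λ v → Adj u v × col c u v ≡ blue

Arrows : ℕ → ℕ → Set
Arrows j s = (c : Colouring j s) → RedButterfly c ⊎ BlueP2 c

MjBP2≡ : ℕ → ℕ → Set
MjBP2≡ j s = Arrows j s × (∀ t → t < s → ¬ Arrows j t)

-- Every edge of a copy of B in K_{j×s} must be red, or else that edge is a blue P_2;
-- so K_{j×s} → (B, P_2) holds exactly when B is a subgraph of K_{j×s}, as the
-- all-red colouring shows. A copy of B needs five vertices pairwise in distinct
-- parts when s = 1, hence j ≥ 5, while K_{3×2} already contains B.
module Submission where

open import Defs
open import Data.Nat using (ℕ; _≤_; _<_; z≤n; s≤s; zero; suc)
open import Data.Nat.Properties using (≤∧≢⇒<; <⇒≱)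
open import Data.Fin using (Fin; zero; suc; inject≤; _≟_)
open import Data.Fin.Properties using (inject≤-injective; injective⇒≤; all?)
open import Data.Product using (Σ; ∃; _×_; _,_; proj₁)
open import Data.Product.Properties using (≡-dec; ,-injective)
open import Data.Sum using (_⊎_; inj₁; inj₂)
open import Data.Unit using (tt)
open import Data.Empty using (⊥-elim)
open import Function using (_∘_; const)
open import Function.Definitions using (Injective)
open import Relation.Nullary using (¬_; Dec; yes; no)
open import Relation.Nullary.Decidable using (_×-dec_; _→-dec_; ¬?; map′; from-yes)
open import Relation.Unary using (Pred)
open import Relation.Binary.PropositionalEquality using (_≡_; refl; cong; ≢-sym)

∀⊎∃ : ∀ {n p q} {P : Pred (Fin n) p} {Q : Pred (Fin n) q} →
      (∀ i → P i ⊎ Q i) → (∀ i → P i) ⊎ ∃ Q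
∀⊎∃ {zero}  _  = inj₁ λ ()
∀⊎∃ {suc n} pq with pq zero | ∀⊎∃ (pq ∘ suc)
... | inj₂ q  | _            = inj₂ (zero , q)
... | inj₁ _  | inj₂ (i , q) = inj₂ (suc i , q)
... | inj₁ p  | inj₁ ps      = inj₁ λ { zero → p ; (suc i) → ps i }

bedge? : ∀ a b → Dec (BEdge a b)
bedge? zero (suc zero)                                      = yes tt
bedge? zero (suc (suc zero))                                = yes tt
bedge? zero (suc (suc (suc zero)))                          = yes tt
bedge? zero (suc (suc (suc (suc zero))))                    = yes tt
bedge? (suc zero) (suc (suc zero))                          = yes tt
bedge? (suc (suc (suc zero))) (suc (suc (suc (suc zero))))  = yes tt
bedge? zero zero                                            = no λ ()
bedge? (suc zero) zero                                      = no λ ()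
bedge? (suc zero) (suc zero)                                = no λ ()
bedge? (suc zero) (suc (suc (suc _)))                       = no λ ()
bedge? (suc (suc zero)) _                                   = no λ ()
bedge? (suc (suc (suc zero))) zero                          = no λ ()
bedge? (suc (suc (suc zero))) (suc zero)                    = no λ ()
bedge? (suc (suc (suc zero))) (suc (suc zero))              = no λ ()
bedge? (suc (suc (suc zero))) (suc (suc (suc zero)))        = no λ ()
bedge? (suc (suc (suc (suc zero)))) _                       = no λ ()

IsButterflyCopy : {j s : ℕ} → (Fin 5 → Vertex j s) → Set
IsButterflyCopy f = Injective _≡_ _≡_ f × (∀ a b → BEdge a b → Adj (f a) (f b))

ButterflyIn : ℕ → ℕ → Set
ButterflyIn j s = Σ (Fin 5 → Vertex j s) IsButterflyCopy

isButterflyCopy? : {j s : ℕ} (f : Fin 5 → Vertex j s) → Dec (IsButterflyCopy f)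
isButterflyCopy? f = injective? ×-dec all? λ a → all? λ b → bedge? a b →-dec ¬? (_ ≟ _)
  where
  injective? : Dec (Injective _≡_ _≡_ f)
  injective? = map′ (λ inj {a} {b} → inj a b) (λ inj a b → inj)
    (all? λ a → all? λ b → ≡-dec _≟_ _≟_ (f a) (f b) →-dec a ≟ b)

butterflyIn⇒arrows : {j s : ℕ} → ButterflyIn j s → Arrows j s
butterflyIn⇒arrows (f , inj , adj) c with ∀⊎∃ (λ a → ∀⊎∃ (edgeRed⊎blue a))
  where
  edgeRed⊎blue : ∀ a b → (BEdge a b → col c (f a) (f b) ≡ red)
                        ⊎ (BEdge a b × col c (f a) (f b) ≡ blue)
  edgeRed⊎blue a b with bedge? a b | col c (f a) (f b)
  ... | no ¬ab | _    = inj₁ (⊥-elim ∘ ¬ab)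
  ... | yes _  | red  = inj₁ (const refl)
  ... | yes ab | blue = inj₂ (ab , refl)
... | inj₁ edgesRed               = inj₁ (f , inj , λ a b ab → adj a b ab , edgesRed a b ab)
... | inj₂ (a , b , ab , isBlue) = inj₂ (f a , f b , adj a b ab , isBlue)

allRed : (j s : ℕ) → Colouring j s
allRed j s = record { col = λ _ _ → red ; sym = λ _ _ → refl }

arrows⇒butterflyIn : {j s : ℕ} → Arrows j s → ButterflyIn j s
arrows⇒butterflyIn {j} {s} arrows with arrows (allRed j s)
... | inj₁ (f , inj , edges) = f , inj , λ a b ab → proj₁ (edges a b ab)
... | inj₂ (_ , _ , _ , ())

butterflyIn-mono : {j k s : ℕ} → j ≤ k → ButterflyIn j s → ButterflyIn k s
butterflyIn-mono j≤k (f , inj , adj) =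
  embed ∘ f , inj ∘ embed-injective , λ a b ab → adj a b ab ∘ inject≤-injective j≤k j≤k _ _
  where
  embed : Vertex _ _ → Vertex _ _
  embed (p , x) = inject≤ p j≤k , x
  embed-injective : Injective _≡_ _≡_ embed
  embed-injective {p , x} {q , y} eq with ,-injective eq
  ... | p≡q , refl = cong (_, x) (inject≤-injective j≤k j≤k p q p≡q)

¬butterflyIn-0 : {j : ℕ} → ¬ ButterflyIn j 0
¬butterflyIn-0 (f , _) with f zero
... | _ , ()

part-injective : {j : ℕ} → Injective _≡_ _≡_ (proj₁ {B = λ (_ : Fin j) → Fin 1})
part-injective {x = p , zero} {.p , zero} refl = refl

butterflyIn-1⇒5≤j : {j : ℕ} → ButterflyIn j 1 → 5 ≤ j
butterflyIn-1⇒5≤j (f , inj , _) = injective⇒≤ (inj ∘ part-injective)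

butterflyIn-3×2 : ButterflyIn 3 2
butterflyIn-3×2 = f , from-yes (isButterflyCopy? f)
  where
  f : Fin 5 → Vertex 3 2
  f zero                         = zero , zero
  f (suc zero)                   = suc zero , zero
  f (suc (suc zero))             = suc (suc zero) , zero
  f (suc (suc (suc zero)))       = suc zero , suc zero
  f (suc (suc (suc (suc zero)))) = suc (suc zero) , suc zero

butterflyIn-5×1 : ButterflyIn 5 1
butterflyIn-5×1 = (_, zero) , from-yes (isButterflyCopy? (_, zero))

¬arrows-0 : {j : ℕ} → ¬ Arrows j 0
¬arrows-0 = ¬butterflyIn-0 ∘ arrows⇒butterflyIn

¬arrows-1 : {j : ℕ} → j < 5 → ¬ Arrows j 1
¬arrows-1 j<5 = <⇒≱ j<5 ∘ butterflyIn-1⇒5≤j ∘ arrows⇒butterflyIn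

arrows-1 : {j : ℕ} → 5 ≤ j → Arrows j 1
arrows-1 5≤j = butterflyIn⇒arrows (butterflyIn-mono 5≤j butterflyIn-5×1)

arrows-2 : {j : ℕ} → 3 ≤ j → Arrows j 2
arrows-2 3≤j = butterflyIn⇒arrows (butterflyIn-mono 3≤j butterflyIn-3×2)

≡3⊎≡4⇒<5 : {j : ℕ} → j ≡ 3 ⊎ j ≡ 4 → j < 5
≡3⊎≡4⇒<5 (inj₁ refl) = s≤s (s≤s (s≤s (s≤s z≤n)))
≡3⊎≡4⇒<5 (inj₂ refl) = s≤s (s≤s (s≤s (s≤s (s≤s z≤n))))

≥3∧≢3∧≢4⇒≥5 : {j : ℕ} → 3 ≤ j → ¬ (j ≡ 3 ⊎ j ≡ 4) → 5 ≤ j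
≥3∧≢3∧≢4⇒≥5 3≤j j∉34 = ≤∧≢⇒< (≤∧≢⇒< 3≤j (≢-sym (j∉34 ∘ inj₁))) (≢-sym (j∉34 ∘ inj₂))

theorem3p1 : (j : ℕ) → 3 ≤ j →
    ((j ≡ 3 ⊎ j ≡ 4) → MjBP2≡ j 2) × (¬ (j ≡ 3 ⊎ j ≡ 4) → MjBP2≡ j 1)
theorem3p1 j 3≤j = small , large
  where
  small : (j ≡ 3 ⊎ j ≡ 4) → MjBP2≡ j 2
  small j∈34 = arrows-2 3≤j , λ
    { zero          _ → ¬arrows-0
    ; (suc zero)    _ → ¬arrows-1 (≡3⊎≡4⇒<5 j∈34)
    ; (suc (suc _)) (s≤s (s≤s ()))
    }

  large : ¬ (j ≡ 3 ⊎ j ≡ 4) → MjBP2≡ j 1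
  large j∉34 = arrows-1 (≥3∧≢3∧≢4⇒≥5 3≤j j∉34) , λ
    { zero    _ → ¬arrows-0
    ; (suc _) (s≤s ())
    }
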